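{- Let $n\ge 2$ and $k\ge 1$ be integers and let $T_m=m(m+1)/2$. The Overall Graph $O_n(k)$ has $$\left\vert O_n(1)\right\vert = T_{n+1},\qquad \left\vert O_n(k)\right\vert=\left\vert O_n(k-1)\right\vert\cdot T_n-n^2+1 \ \ (k\ge 2),$$ and consequently, for all $k\ge 1$, $$\left\vert O_n(k)\right\vert=\frac{(n+4)\left(\frac{n(n+1)}{2}\right)^k+2(n+1)}{n+2}.$$
   Context: $T_m=m(m+1)/2$ denotes the $m$-th triangular number. For an integer $n\ge 2$, the generator pattern $F_n$ is an equilateral triangle of side length $n$ (horizontal base, apex up) subdivided by lines parallel to its sides into $n^2$ unit equilateral triangles ("tiles"); the $T_n$ tiles pointing upwards are coloured dark and the $T_{n-1}$ tiles pointing downwards are white. Set $F_n(1)=F_n$, and for $k\ge 2$ obtain $F_n(k)$ from $F_n$ by replacing every dark tile with a correspondingly scaled copy of $F_n(k-1)$; thus $F_n(k)$ has $T_n^k$ dark tiles (it is an approximation of the generalized Sierpiński gasket). The Overall Graph $O_n(k)$ is the graph whose vertices are all corners of the dark tiles of $F_n(k)$ and whose edges are the sides of the dark tiles of $F_n(k)$ (two vertices are adjacent iff they are the two endpoints of a side of some dark tile). $\left\vert O_n(k)\right\vert$ denotes its number of vertices. -}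

module Defs where

open import Data.Bool using (Bool; true; false; _∧_; _∨_; if_then_else_)
open import Data.Nat using (ℕ; zero; suc; _+_; _*_; _∸_; _^_; _<ᵇ_; _/_; _%_)
open import Data.Nat.Properties using (m^n≢0)
open import Data.List using (List; map; upTo; cartesianProduct)
open import Data.Nat.ListAction using (sum)
open import Data.Product using (_×_; _,_)

T : ℕ → ℕ
T m = (m * (m + 1)) / 2

-- Coordinates: the lattice point (a , b) denotes a·e₁ + b·e₂ with
-- e₁ = (1,0), e₂ = (1/2, √3/2); the big triangle of side N has corners
-- (0,0), (N,0), (0,N). The upward unit tile with lower-left corner (i , j)
-- has corners (i , j), (i+1 , j), (i , j+1).
--
-- dark n k i j : the upward unit tile (i , j) is a dark tile of F_n(k).
-- Level 0 is an auxiliary single dark tile (side n^0 = 1), so that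
-- dark n 1 i j = (i + j < n) is exactly the generator F_n, and
-- F_n(k+1) is F_n with every dark tile (blocks of side n^k) replaced by F_n(k).
-- The case n = 0 is junk (never used: the theorem assumes n ≥ 2).
dark : ℕ → ℕ → ℕ → ℕ → Bool
dark zero    _       _ _ = false
dark (suc m) zero    i j = (i + j) <ᵇ 1
dark (suc m) (suc k) i j =
  (((i / s) {{nz}} + (j / s) {{nz}}) <ᵇ suc m)
  ∧ dark (suc m) k ((i % s) {{nz}}) ((j % s) {{nz}})
  where
  s = suc m ^ k
  nz = m^n≢0 (suc m) k

side : ℕ → ℕ → ℕ
side n k = n ^ k

isVertex : ℕ → ℕ → ℕ → ℕ → Bool
isVertex n k zero    zero    = dark n k 0 0
isVertex n k (suc a) zero    = dark n k (suc a) 0 ∨ dark n k a 0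
isVertex n k zero    (suc b) = dark n k 0 (suc b) ∨ dark n k 0 b
isVertex n k (suc a) (suc b) =
  dark n k (suc a) (suc b) ∨ dark n k a (suc b) ∨ dark n k (suc a) b

-- All candidate lattice points (a , b) with 0 ≤ a , b ≤ side
-- (every corner of a tile of F_n(k) lies among them).
candidates : ℕ → ℕ → List (ℕ × ℕ)
candidates n k = cartesianProduct (upTo (suc (side n k))) (upTo (suc (side n k)))

indicator : Bool → ℕ
indicator true  = 1
indicator false = 0

-- |O_n(k)| : number of vertices of the Overall Graph O_n(k)
-- (vertices = all corners of dark tiles of F_n(k)).
overallSize : ℕ → ℕ → ℕ
overallSize n k = sum (map (λ { (a , b) → indicator (isVertex n k a b) }) (candidates n k))

module Submission where

-- Cut the grid of F_n(k+1) into blocks of side n^k, indexed by (p , q), with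
-- offsets (a , b) inside a block. A point at a nonzero offset is a vertex iff
-- its block is a dark tile of F_n (p + q < n) and the offset is a vertex of
-- F_n(k); a block corner is a vertex iff (p , q) is a vertex of F_n
-- (p + q ≤ n). Of the corners of F_n(k) only (0 , 0) lies in the half-open
-- block, so summing gives |O_n(k+1)| = T_{n+1} + T_n (|O_n(k)| − 3), with
-- |O_n(0)| = 3 for the single tile. Both identities follow from this
-- recurrence by arithmetic, using 2 T_n = n (n + 1).

open import Defs
open import Data.Nat using (ℕ; suc; _+_; _*_; _^_; _≤_; _∸_)
open import Data.Product using (_×_)
open import Relation.Binary.PropositionalEquality using (_≡_)

open import Data.Bool using (Bool; true; false; _∧_; _∨_) renaming (T to So)
open import Data.Bool.Properties
  using (T-∧; T-∨; ∧-distribˡ-∨; ∧-zeroʳ; ∧-identityʳ; ∨-identityʳ; ∨-zeroʳ; ∨-idem)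
open import Data.Empty using (⊥-elim)
open import Data.List using (List; []; _∷_; _++_; map; applyUpTo; upTo; cartesianProduct)
open import Data.List.Properties using (map-++; map-∘)
open import Data.Nat using (zero; _<_; _<ᵇ_; z≤n; s≤s; z<s; NonZero; _/_; _%_)
open import Data.Nat.DivMod
  using (m≡m%n+[m/n]*n; +-distrib-/-∣ʳ; m<n⇒m/n≡0; m*n/n≡m; [m+kn]%n≡m%n; m<n⇒m%n≡m)
open import Data.Nat.Divisibility using (n∣m*n)
open import Data.Nat.ListAction using (sum)
open import Data.Nat.ListAction.Properties using (sum-++)
open import Data.Nat.Properties
open import Algebra.Properties.CommutativeSemigroup +-commutativeSemigroup
  using (interchange; x∙yz≈y∙xz)
open import Data.Nat.Tactic.RingSolver using (solve-∀)
open import Data.Product using (_,_; proj₁; proj₂)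
open import Data.Sum using (_⊎_; inj₁; inj₂)
open import Data.Unit using (tt)
open import Function using (_∘_; id)
open import Function.Bundles using (Equivalence)
open import Relation.Binary.PropositionalEquality
  using (refl; sym; trans; cong; cong₂; subst; module ≡-Reasoning)

open ≡-Reasoning

∑< : ℕ → (ℕ → ℕ) → ℕ
∑< zero    f = 0
∑< (suc L) f = f 0 + ∑< L (f ∘ suc)

syntax ∑< L (λ i → e) = ∑[ i < L ] e

∑-cong : ∀ L {f g : ℕ → ℕ} → (∀ i → i < L → f i ≡ g i) → ∑< L f ≡ ∑< L g
∑-cong zero    f≗g = refl
∑-cong (suc L) f≗g = cong₂ _+_ (f≗g 0 (s≤s z≤n)) (∑-cong L (λ i i<L → f≗g (suc i) (s≤s i<L)))

∑-zero : ∀ L {f : ℕ → ℕ} → (∀ i → f i ≡ 0) → ∑< L f ≡ 0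
∑-zero zero    f≗0 = refl
∑-zero (suc L) f≗0 = cong₂ _+_ (f≗0 0) (∑-zero L (f≗0 ∘ suc))

∑-head : ∀ L .{{_ : NonZero L}} {f : ℕ → ℕ} → (∀ i → f (suc i) ≡ 0) → ∑< L f ≡ f 0
∑-head (suc L) tail≗0 = trans (cong (_ +_) (∑-zero L tail≗0)) (+-identityʳ _)

∑-distrib-+ : ∀ L (f g : ℕ → ℕ) → ∑[ i < L ] (f i + g i) ≡ ∑< L f + ∑< L g
∑-distrib-+ zero    f g = refl
∑-distrib-+ (suc L) f g = begin
  f 0 + g 0 + ∑[ i < L ] (f (suc i) + g (suc i))  ≡⟨ cong (f 0 + g 0 +_) (∑-distrib-+ L (f ∘ suc) (g ∘ suc)) ⟩
  f 0 + g 0 + (∑< L (f ∘ suc) + ∑< L (g ∘ suc))   ≡⟨ interchange (f 0) (g 0) _ _ ⟩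
  f 0 + ∑< L (f ∘ suc) + (g 0 + ∑< L (g ∘ suc))   ∎

*-distribˡ-∑ : ∀ L c (f : ℕ → ℕ) → c * ∑< L f ≡ ∑[ i < L ] (c * f i)
*-distribˡ-∑ zero    c f = *-zeroʳ c
*-distribˡ-∑ (suc L) c f = trans (*-distribˡ-+ c (f 0) _) (cong (c * f 0 +_) (*-distribˡ-∑ L c (f ∘ suc)))

*-distribʳ-∑ : ∀ L c (f : ℕ → ℕ) → ∑< L f * c ≡ ∑[ i < L ] (f i * c)
*-distribʳ-∑ L c f = trans (*-comm _ c) (trans (*-distribˡ-∑ L c f) (∑-cong L (λ i _ → *-comm c (f i))))

∑-split : ∀ L M (f : ℕ → ℕ) → ∑< (L + M) f ≡ ∑< L f + ∑[ i < M ] f (L + i)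
∑-split zero    M f = refl
∑-split (suc L) M f = trans (cong (f 0 +_) (∑-split L M (f ∘ suc))) (sym (+-assoc (f 0) _ _))

∑-last : ∀ L (f : ℕ → ℕ) → ∑< (suc L) f ≡ ∑< L f + f L
∑-last zero    f = +-identityʳ (f 0)
∑-last (suc L) f = trans (cong (f 0 +_) (∑-last L (f ∘ suc))) (sym (+-assoc (f 0) _ _))

∑-extend : ∀ L M (f : ℕ → ℕ) → (∀ i → f (L + i) ≡ 0) → ∑< (L + M) f ≡ ∑< L f
∑-extend L M f beyond≗0 = trans (∑-split L M f) (trans (cong (∑< L f +_) (∑-zero M beyond≗0)) (+-identityʳ _))

∑-blocks : ∀ P S (f : ℕ → ℕ) → ∑< (P * S) f ≡ ∑[ q < P ] ∑[ r < S ] f (r + q * S)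
∑-blocks zero    S f = refl
∑-blocks (suc P) S f = begin
  ∑< (S + P * S) f
    ≡⟨ ∑-split S (P * S) f ⟩
  ∑< S f + ∑[ i < P * S ] f (S + i)
    ≡⟨ cong₂ _+_ (∑-cong S (λ r _ → cong f (sym (+-identityʳ r))))
                 (∑-blocks P S (λ i → f (S + i))) ⟩
  ∑[ r < S ] f (r + 0) + ∑[ q < P ] ∑[ r < S ] f (S + (r + q * S))
    ≡⟨ cong (_ +_) (∑-cong P (λ q _ → ∑-cong S (λ r _ → cong f (x∙yz≈y∙xz S r (q * S))))) ⟩
  ∑[ r < S ] f (r + 0) + ∑[ q < P ] ∑[ r < S ] f (r + (S + q * S)) ∎

∑-comm : ∀ A B (f : ℕ → ℕ → ℕ) → ∑[ i < A ] ∑[ j < B ] f i j ≡ ∑[ j < B ] ∑[ i < A ] f i j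
∑-comm zero    B f = sym (∑-zero B (λ _ → refl))
∑-comm (suc A) B f = begin
  ∑< B (f 0) + ∑[ i < A ] ∑[ j < B ] f (suc i) j  ≡⟨ cong (∑< B (f 0) +_) (∑-comm A B (f ∘ suc)) ⟩
  ∑< B (f 0) + ∑[ j < B ] ∑[ i < A ] f (suc i) j  ≡⟨ sym (∑-distrib-+ B (f 0) _) ⟩
  ∑[ j < B ] (f 0 j + ∑[ i < A ] f (suc i) j)      ∎

∑² : ℕ → (ℕ → ℕ → ℕ) → ℕ
∑² L f = ∑[ a < L ] ∑[ b < L ] f a b

∑²-cong : ∀ L {f g : ℕ → ℕ → ℕ} → (∀ a b → a < L → b < L → f a b ≡ g a b) → ∑² L f ≡ ∑² L g
∑²-cong L f≗g = ∑-cong L (λ a a<L → ∑-cong L (λ b b<L → f≗g a b a<L b<L))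

∑²-distrib-+ : ∀ L (f g : ℕ → ℕ → ℕ) → ∑² L (λ a b → f a b + g a b) ≡ ∑² L f + ∑² L g
∑²-distrib-+ L f g = trans (∑-cong L (λ a _ → ∑-distrib-+ L (f a) (g a))) (∑-distrib-+ L _ _)

*-distribˡ-∑² : ∀ L c (f : ℕ → ℕ → ℕ) → c * ∑² L f ≡ ∑² L (λ a b → c * f a b)
*-distribˡ-∑² L c f = trans (*-distribˡ-∑ L c _) (∑-cong L (λ a _ → *-distribˡ-∑ L c (f a)))

*-distribʳ-∑² : ∀ L c (f : ℕ → ℕ → ℕ) → ∑² L f * c ≡ ∑² L (λ a b → f a b * c)
*-distribʳ-∑² L c f = trans (*-distribʳ-∑ L c _) (∑-cong L (λ a _ → *-distribʳ-∑ L c (f a)))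

∑²-last : ∀ L (f : ℕ → ℕ → ℕ) →
  ∑² (suc L) f ≡ ∑² L f + ∑[ a < L ] f a L + ∑< (suc L) (f L)
∑²-last L f = trans (∑-last L _) (cong (_+ ∑< (suc L) (f L))
  (trans (∑-cong L (λ a _ → ∑-last L (f a))) (∑-distrib-+ L _ _)))

∑²-extend : ∀ L M (f : ℕ → ℕ → ℕ) → (∀ a b → L ≤ a ⊎ L ≤ b → f a b ≡ 0) → ∑² (L + M) f ≡ ∑² L f
∑²-extend L M f outside≗0 =
  trans (∑-extend L M _ (λ i → ∑-zero (L + M) (λ b → outside≗0 (L + i) b (inj₁ (m≤m+n L i)))))
        (∑-cong L (λ a _ → ∑-extend L M (f a) (λ i → outside≗0 a (L + i) (inj₂ (m≤m+n L i)))))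

∑²-blocks : ∀ P S (f : ℕ → ℕ → ℕ) →
  ∑² (P * S) f ≡ ∑² P (λ x y → ∑² S (λ a b → f (a + x * S) (b + y * S)))
∑²-blocks P S f = begin
  ∑² (P * S) f
    ≡⟨ ∑-blocks P S _ ⟩
  ∑[ x < P ] ∑[ a < S ] ∑< (P * S) (f (a + x * S))
    ≡⟨ ∑-cong P (λ x _ → ∑-cong S (λ a _ → ∑-blocks P S _)) ⟩
  ∑[ x < P ] ∑[ a < S ] ∑[ y < P ] ∑[ b < S ] f (a + x * S) (b + y * S)
    ≡⟨ ∑-cong P (λ x _ → ∑-comm S P _) ⟩
  ∑² P (λ x y → ∑² S (λ a b → f (a + x * S) (b + y * S))) ∎

sum-map-applyUpTo : ∀ (f g : ℕ → ℕ) L → sum (map f (applyUpTo g L)) ≡ ∑[ i < L ] f (g i)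
sum-map-applyUpTo f g zero    = refl
sum-map-applyUpTo f g (suc L) = cong (f (g 0) +_) (sum-map-applyUpTo f (g ∘ suc) L)

sum-map-cartesianProduct : ∀ {A B : Set} (h : A × B → ℕ) xs (ys : List B) →
  sum (map h (cartesianProduct xs ys)) ≡ sum (map (λ x → sum (map (λ y → h (x , y)) ys)) xs)
sum-map-cartesianProduct h []       ys = refl
sum-map-cartesianProduct h (x ∷ xs) ys = begin
  sum (map h (map (x ,_) ys ++ cartesianProduct xs ys))
    ≡⟨ cong sum (map-++ h (map (x ,_) ys) _) ⟩
  sum (map h (map (x ,_) ys) ++ map h (cartesianProduct xs ys))
    ≡⟨ sum-++ (map h (map (x ,_) ys)) _ ⟩
  sum (map h (map (x ,_) ys)) + sum (map h (cartesianProduct xs ys))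
    ≡⟨ cong₂ _+_ (cong sum (sym (map-∘ ys))) (sum-map-cartesianProduct h xs ys) ⟩
  sum (map (λ y → h (x , y)) ys) + sum (map (λ x → sum (map (λ y → h (x , y)) ys)) xs) ∎

sum-grid≡∑² : ∀ L (f : ℕ → ℕ → ℕ) →
  sum (map (λ { (a , b) → f a b }) (cartesianProduct (upTo L) (upTo L))) ≡ ∑² L f
sum-grid≡∑² L f = begin
  _ ≡⟨ sum-map-cartesianProduct _ (upTo L) (upTo L) ⟩
  _ ≡⟨ sum-map-applyUpTo (λ a → sum (map (f a) (upTo L))) id L ⟩
  _ ≡⟨ ∑-cong L (λ a _ → sum-map-applyUpTo (f a) id L) ⟩
  ∑² L f ∎

triangle : ℕ → ℕ
triangle zero    = 0
triangle (suc c) = suc c + triangle c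

triangle-double : ∀ c → triangle c * 2 ≡ c * (c + 1)
triangle-double zero    = refl
triangle-double (suc c) = begin
  (suc c + triangle c) * 2      ≡⟨ *-distribʳ-+ 2 (suc c) (triangle c) ⟩
  suc c * 2 + triangle c * 2    ≡⟨ cong (suc c * 2 +_) (triangle-double c) ⟩
  suc c * 2 + c * (c + 1)       ≡⟨ step c ⟩
  suc c * (suc c + 1)           ∎
  where
  step : ∀ c → suc c * 2 + c * (c + 1) ≡ suc c * (suc c + 1)
  step = solve-∀

T≡triangle : ∀ c → T c ≡ triangle c
T≡triangle c = trans (cong (_/ 2) (sym (triangle-double c))) (m*n/n≡m (triangle c) 2)

<ᵇ-zero : ∀ q → (q <ᵇ 0) ≡ false
<ᵇ-zero zero    = refl
<ᵇ-zero (suc q) = refl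

+-<ᵇ≡<ᵇ-∸ : ∀ p q c → (p + q <ᵇ c) ≡ (q <ᵇ c ∸ p)
+-<ᵇ≡<ᵇ-∸ zero    q c       = refl
+-<ᵇ≡<ᵇ-∸ (suc p) q zero    = sym (<ᵇ-zero q)
+-<ᵇ≡<ᵇ-∸ (suc p) q (suc c) = +-<ᵇ≡<ᵇ-∸ p q c

∑-indicator-<ᵇ : ∀ c L → c ≤ L → ∑[ q < L ] indicator (q <ᵇ c) ≡ c
∑-indicator-<ᵇ zero    L       _         = ∑-zero L (λ q → cong indicator (<ᵇ-zero q))
∑-indicator-<ᵇ (suc c) (suc L) (s≤s c≤L) = cong suc (∑-indicator-<ᵇ c L c≤L)

∑-∸≡triangle : ∀ c L → c ≤ L → ∑[ p < L ] (c ∸ p) ≡ triangle c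
∑-∸≡triangle zero    L       _         = ∑-zero L (λ p → 0∸n≡0 p)
∑-∸≡triangle (suc c) (suc L) (s≤s c≤L) = cong (suc c +_) (∑-∸≡triangle c L c≤L)

∑²-triangle : ∀ c L → c ≤ L → ∑² L (λ p q → indicator (p + q <ᵇ c)) ≡ triangle c
∑²-triangle c L c≤L = begin
  ∑² L (λ p q → indicator (p + q <ᵇ c))
    ≡⟨ ∑²-cong L (λ p q _ _ → cong indicator (+-<ᵇ≡<ᵇ-∸ p q c)) ⟩
  ∑² L (λ p q → indicator (q <ᵇ c ∸ p))
    ≡⟨ ∑-cong L (λ p _ → ∑-indicator-<ᵇ (c ∸ p) L (≤-trans (m∸n≤m c p) c≤L)) ⟩
  ∑[ p < L ] (c ∸ p)
    ≡⟨ ∑-∸≡triangle c L c≤L ⟩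
  triangle c ∎

recurrence-arith : ∀ n w → triangle (suc n) + triangle n * w + n ^ 2 ≡ (w + 3) * triangle n + 1
recurrence-arith n w = +-cancelʳ-≡ (triangle n * 2) _ _ (begin
  suc n + t + t * w + n ^ 2 + t * 2   ≡⟨ expand n t w ⟩
  (w + 3) * t + 1 + n * (n + 1)       ≡⟨ cong ((w + 3) * t + 1 +_) (sym (triangle-double n)) ⟩
  (w + 3) * t + 1 + t * 2             ∎)
  where
  t = triangle n
  expand : ∀ n t w → suc n + t + t * w + n * (n * 1) + t * 2 ≡ (w + 3) * t + 1 + n * (n + 1)
  expand = solve-∀

closedForm-step : ∀ n w x → (n + 2) * (w + 3) ≡ (n + 4) * x + 2 * (n + 1) →
  (n + 2) * (triangle (suc n) + triangle n * w) ≡ (n + 4) * (triangle n * x) + 2 * (n + 1)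
closedForm-step n w x hyp = +-cancelʳ-≡ (3 * (n + 2) * t) _ _ (+-cancelʳ-≡ (t * 2) _ _ (begin
  (n + 2) * (suc n + t + t * w) + 3 * (n + 2) * t + t * 2
    ≡⟨ cong (_+ t * 2) (regroup n t w) ⟩
  (n + 2) * (suc n + t) + t * ((n + 2) * (w + 3)) + t * 2
    ≡⟨ cong (λ z → (n + 2) * (suc n + t) + t * z + t * 2) hyp ⟩
  (n + 2) * (suc n + t) + t * ((n + 4) * x + 2 * (n + 1)) + t * 2
    ≡⟨ expand n t x ⟩
  (n + 4) * (t * x) + 2 * (n + 1) + 3 * (n + 2) * t + n * (n + 1)
    ≡⟨ cong ((n + 4) * (t * x) + 2 * (n + 1) + 3 * (n + 2) * t +_) (sym (triangle-double n)) ⟩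
  (n + 4) * (t * x) + 2 * (n + 1) + 3 * (n + 2) * t + t * 2 ∎))
  where
  t = triangle n
  regroup : ∀ n t w → (n + 2) * (suc n + t + t * w) + 3 * (n + 2) * t
                      ≡ (n + 2) * (suc n + t) + t * ((n + 2) * (w + 3))
  regroup = solve-∀
  expand : ∀ n t x → (n + 2) * (suc n + t) + t * ((n + 4) * x + 2 * (n + 1)) + t * 2
                     ≡ (n + 4) * (t * x) + 2 * (n + 1) + 3 * (n + 2) * t + n * (n + 1)
  expand = solve-∀

<ᵇ-suc : ∀ x → (x <ᵇ suc x) ≡ true
<ᵇ-suc zero    = refl
<ᵇ-suc (suc x) = <ᵇ-suc x

<ᵇ-suc-∨ : ∀ x c → ((suc x <ᵇ c) ∨ (x <ᵇ c)) ≡ (x <ᵇ c)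
<ᵇ-suc-∨ zero    zero          = refl
<ᵇ-suc-∨ zero    (suc zero)    = refl
<ᵇ-suc-∨ zero    (suc (suc c)) = refl
<ᵇ-suc-∨ (suc x) zero          = refl
<ᵇ-suc-∨ (suc x) (suc c)       = <ᵇ-suc-∨ x c

∨-factorˡ : ∀ d {x y x′ y′} → x ≡ d ∧ x′ → y ≡ d ∧ y′ → (x ∨ y) ≡ d ∧ (x′ ∨ y′)
∨-factorˡ d {x′ = x′} {y′} refl refl = sym (∧-distribˡ-∨ d x′ y′)

∨-factorˡ-∨false : ∀ d {x y z x′ y′} → x ≡ d ∧ x′ → y ≡ d ∧ y′ → z ≡ false →
  (x ∨ y ∨ z) ≡ d ∧ (x′ ∨ y′)
∨-factorˡ-∨false d {x′ = x′} {y′} refl refl refl =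
  trans (cong (d ∧ x′ ∨_) (∨-identityʳ (d ∧ y′))) (sym (∧-distribˡ-∨ d x′ y′))

∨-factorˡ-false∨ : ∀ d {x y z x′ z′} → x ≡ d ∧ x′ → y ≡ false → z ≡ d ∧ z′ →
  (x ∨ y ∨ z) ≡ d ∧ (x′ ∨ z′)
∨-factorˡ-false∨ d {x′ = x′} {z′} refl refl refl = sym (∧-distribˡ-∨ d x′ z′)

indicator-∧ : ∀ x y → indicator (x ∧ y) ≡ indicator x * indicator y
indicator-∧ true  true  = refl
indicator-∧ true  false = refl
indicator-∧ false y     = refl

[m+kn]/n≡k : ∀ {m} k {n} .{{_ : NonZero n}} → m < n → (m + k * n) / n ≡ k
[m+kn]/n≡k {m} k {n} m<n = begin
  (m + k * n) / n    ≡⟨ +-distrib-/-∣ʳ m (n∣m*n k) ⟩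
  m / n + k * n / n  ≡⟨ cong₂ _+_ (m<n⇒m/n≡0 m<n) (m*n/n≡m k n) ⟩
  k                  ∎

[m+kn]%n≡m : ∀ {m} k {n} .{{_ : NonZero n}} → m < n → (m + k * n) % n ≡ m
[m+kn]%n≡m {m} k {n} m<n = trans ([m+kn]%n≡m%n m k n) (m<n⇒m%n≡m m<n)

origin : ℕ → ℕ → ℕ
origin zero    zero    = 1
origin zero    (suc b) = 0
origin (suc a) b       = 0

∑²-origin : ∀ L .{{_ : NonZero L}} → ∑² L origin ≡ 1
∑²-origin L = trans (∑-head L {λ a → ∑< L (origin a)} (λ a → ∑-zero L (λ b → refl)))
                    (∑-head L {origin 0} (λ b → refl))

module OverallGraph (m : ℕ) where

  private
    n : ℕ
    n = suc m

  side-nonZero : ∀ k → NonZero (side n k)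
  side-nonZero k = m^n≢0 n k

  -- F_n itself, read on block indices: block (p , q) of F_n(k+1) is a copy of
  -- F_n(k) iff dark₁ p q, and its corner is a vertex iff isVertex₁ p q.
  dark₁ : ℕ → ℕ → Bool
  dark₁ p q = p + q <ᵇ n

  isVertex₁ : ℕ → ℕ → Bool
  isVertex₁ p q = p + q <ᵇ suc n

  dark-blocks : ∀ k p q {a b} → a < side n k → b < side n k →
    dark n (suc k) (a + p * side n k) (b + q * side n k) ≡ dark₁ p q ∧ dark n k a b
  dark-blocks k p q a<s b<s = cong₂ _∧_
    (cong (_<ᵇ n) (cong₂ _+_ ([m+kn]/n≡k p a<s) ([m+kn]/n≡k q b<s)))
    (cong₂ (dark n k) ([m+kn]%n≡m p a<s) ([m+kn]%n≡m q b<s))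
    where instance _ = side-nonZero k

  dark⇒<side : ∀ k i j → So (dark n k i j) → i + j < side n k
  dark⇒<side zero    i j d = <ᵇ⇒< (i + j) 1 d
  dark⇒<side (suc k) i j d = subst (_< side n (suc k)) (sym decompose) (<-≤-trans
    (+-monoˡ-< _ (dark⇒<side k (i % s) (j % s) (proj₂ inTile)))
    (+-monoʳ-≤ s (*-monoˡ-≤ s (≤-pred (<ᵇ⇒< (i / s + j / s) n (proj₁ inTile))))))
    where
    s = side n k
    instance _ = side-nonZero k
    inTile = Equivalence.to T-∧ d
    regroup : ∀ u x v y t → (u + x * t) + (v + y * t) ≡ (u + v) + (x + y) * t
    regroup = solve-∀
    decompose : i + j ≡ (i % s + j % s) + (i / s + j / s) * s
    decompose = trans (cong₂ _+_ (m≡m%n+[m/n]*n i s) (m≡m%n+[m/n]*n j s))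
                      (regroup (i % s) (i / s) (j % s) (j / s) s)

  dark-outside : ∀ k i j → side n k ≤ i + j → dark n k i j ≡ false
  dark-outside k i j s≤i+j with dark n k i j in eq
  ... | false = refl
  ... | true  = ⊥-elim (<⇒≱ (dark⇒<side k i j (subst So (sym eq) tt)) s≤i+j)

  maxIndex : ℕ → ℕ
  maxIndex zero    = 0
  maxIndex (suc k) = maxIndex k + m * side n k

  suc-maxIndex : ∀ k → suc (maxIndex k) ≡ side n k
  suc-maxIndex zero    = refl
  suc-maxIndex (suc k) = cong (_+ m * side n k) (suc-maxIndex k)

  maxIndex<side : ∀ k → maxIndex k < side n k
  maxIndex<side k = ≤-reflexive (suc-maxIndex k)

  0<side : ∀ k → 0 < side n k
  0<side k = ≤-trans (s≤s z≤n) (maxIndex<side k)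

  dark-origin : ∀ k → dark n k 0 0 ≡ true
  dark-origin zero    = refl
  dark-origin (suc k) = trans (dark-blocks k 0 0 (0<side k) (0<side k)) (dark-origin k)

  dark-maxIndex-0 : ∀ k → dark n k (maxIndex k) 0 ≡ true
  dark-maxIndex-0 zero    = refl
  dark-maxIndex-0 (suc k) = trans (dark-blocks k m 0 (maxIndex<side k) (0<side k))
    (cong₂ _∧_ (trans (cong (_<ᵇ n) (+-identityʳ m)) (<ᵇ-suc m)) (dark-maxIndex-0 k))

  dark-0-maxIndex : ∀ k → dark n k 0 (maxIndex k) ≡ true
  dark-0-maxIndex zero    = refl
  dark-0-maxIndex (suc k) = trans (dark-blocks k 0 m (0<side k) (maxIndex<side k))
    (cong₂ _∧_ (<ᵇ-suc m) (dark-0-maxIndex k))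

  dark-suc-maxIndex : ∀ k a → dark n k (suc a) (maxIndex k) ≡ false
  dark-suc-maxIndex k a = dark-outside k (suc a) (maxIndex k)
    (subst (_≤ suc a + maxIndex k) (suc-maxIndex k) (m<n+m (maxIndex k) z<s))

  dark-maxIndex-suc : ∀ k b → dark n k (maxIndex k) (suc b) ≡ false
  dark-maxIndex-suc k b = dark-outside k (maxIndex k) (suc b)
    (subst (_≤ maxIndex k + suc b) (suc-maxIndex k) (m<m+n (maxIndex k) z<s))

  vertex : ℕ → ℕ → ℕ → ℕ
  vertex k a b = indicator (isVertex n k a b)

  nonOriginVertex : ℕ → ℕ → ℕ → ℕ
  nonOriginVertex k zero zero = 0
  nonOriginVertex k a    b    = vertex k a b

  vertex≡origin+nonOriginVertex : ∀ k a b → vertex k a b ≡ origin a b + nonOriginVertex k a b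
  vertex≡origin+nonOriginVertex k zero    zero    = cong indicator (dark-origin k)
  vertex≡origin+nonOriginVertex k zero    (suc b) = refl
  vertex≡origin+nonOriginVertex k (suc a) b       = refl

  isVertex⇒≤side : ∀ k a b → So (isVertex n k a b) → a + b ≤ side n k
  isVertex⇒≤side k zero    zero    v = <⇒≤ (dark⇒<side k 0 0 v)
  isVertex⇒≤side k (suc a) zero    v with Equivalence.to T-∨ v
  ... | inj₁ d = <⇒≤ (dark⇒<side k (suc a) 0 d)
  ... | inj₂ d = dark⇒<side k a 0 d
  isVertex⇒≤side k zero    (suc b) v with Equivalence.to T-∨ v
  ... | inj₁ d = <⇒≤ (dark⇒<side k 0 (suc b) d)
  ... | inj₂ d = dark⇒<side k 0 b d
  isVertex⇒≤side k (suc a) (suc b) v with Equivalence.to T-∨ v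
  ... | inj₁ d = <⇒≤ (dark⇒<side k (suc a) (suc b) d)
  ... | inj₂ v′ with Equivalence.to T-∨ v′
  ...   | inj₁ d = dark⇒<side k a (suc b) d
  ...   | inj₂ d = ≤-trans (≤-reflexive (cong suc (+-suc a b))) (dark⇒<side k (suc a) b d)

  vertex-outside : ∀ k a b → side n k < a + b → vertex k a b ≡ 0
  vertex-outside k a b s<a+b with isVertex n k a b in eq
  ... | false = refl
  ... | true  = ⊥-elim (<⇒≱ s<a+b (isVertex⇒≤side k a b (subst So (sym eq) tt)))

  vertex-0-side : ∀ k → vertex k 0 (side n k) ≡ 1
  vertex-0-side k = trans (cong (vertex k 0) (sym (suc-maxIndex k)))
    (cong indicator (trans (cong (dark n k 0 (suc (maxIndex k)) ∨_) (dark-0-maxIndex k)) (∨-zeroʳ _)))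

  vertex-side-0 : ∀ k → vertex k (side n k) 0 ≡ 1
  vertex-side-0 k = trans (cong (λ a → vertex k a 0) (sym (suc-maxIndex k)))
    (cong indicator (trans (cong (dark n k (suc (maxIndex k)) 0 ∨_) (dark-maxIndex-0 k)) (∨-zeroʳ _)))

  overallSize≡∑²+2 : ∀ k → overallSize n k ≡ ∑² (side n k) (vertex k) + 2
  overallSize≡∑²+2 k = begin
    overallSize n k
      ≡⟨ sum-grid≡∑² (suc s) (vertex k) ⟩
    ∑² (suc s) (vertex k)
      ≡⟨ ∑²-last s (vertex k) ⟩
    ∑² s (vertex k) + ∑[ a < s ] vertex k a s + ∑< (suc s) (vertex k s)
      ≡⟨ cong₂ (λ x y → ∑² s (vertex k) + x + y) topEdge rightEdge ⟩
    ∑² s (vertex k) + 1 + 1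
      ≡⟨ +-assoc _ 1 1 ⟩
    ∑² s (vertex k) + 2 ∎
    where
    s = side n k
    instance _ = side-nonZero k
    topEdge : ∑[ a < s ] vertex k a s ≡ 1
    topEdge = trans (∑-head s {λ a → vertex k a s} (λ a → vertex-outside k (suc a) s (m<n+m s z<s))) (vertex-0-side k)
    rightEdge : ∑< (suc s) (vertex k s) ≡ 1
    rightEdge = trans (∑-head (suc s) {vertex k s} (λ b → vertex-outside k s (suc b) (m<m+n s z<s))) (vertex-side-0 k)

  overallSize≡∑²nonOrigin+3 : ∀ k → overallSize n k ≡ ∑² (side n k) (nonOriginVertex k) + 3
  overallSize≡∑²nonOrigin+3 k = begin
    overallSize n k
      ≡⟨ overallSize≡∑²+2 k ⟩
    ∑² s (vertex k) + 2
      ≡⟨ cong (_+ 2) (∑²-cong s (λ a b _ _ → vertex≡origin+nonOriginVertex k a b)) ⟩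
    ∑² s (λ a b → origin a b + nonOriginVertex k a b) + 2
      ≡⟨ cong (_+ 2) (trans (∑²-distrib-+ s origin _) (cong (_+ ∑² s (nonOriginVertex k)) (∑²-origin s))) ⟩
    suc (∑² s (nonOriginVertex k)) + 2
      ≡⟨ sym (+-suc _ 2) ⟩
    ∑² s (nonOriginVertex k) + 3 ∎
    where
    s = side n k
    instance _ = side-nonZero k

  isVertex₁-suc-suc : ∀ p q →
    (dark₁ (suc p) (suc q) ∨ dark₁ p (suc q) ∨ dark₁ (suc p) q) ≡ isVertex₁ (suc p) (suc q)
  isVertex₁-suc-suc p q = begin
    (suc x <ᵇ n) ∨ (x <ᵇ n) ∨ (suc (p + q) <ᵇ n)  ≡⟨ cong (λ y → (suc x <ᵇ n) ∨ (x <ᵇ n) ∨ (y <ᵇ n)) (sym (+-suc p q)) ⟩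
    (suc x <ᵇ n) ∨ (x <ᵇ n) ∨ (x <ᵇ n)            ≡⟨ cong ((suc x <ᵇ n) ∨_) (∨-idem (x <ᵇ n)) ⟩
    (suc x <ᵇ n) ∨ (x <ᵇ n)                      ≡⟨ <ᵇ-suc-∨ x n ⟩
    x <ᵇ n                                       ∎
    where x = p + suc q

  module _ (k : ℕ) where

    private
      s = side n k
      M = maxIndex k

    blockStart-suc : ∀ p → suc p * s ≡ suc (M + p * s)
    blockStart-suc p = cong (_+ p * s) (sym (suc-maxIndex k))

    darkTile : ∀ {x y} p q a b → x ≡ a + p * s → y ≡ b + q * s → a < s → b < s →
      dark n (suc k) x y ≡ dark₁ p q ∧ dark n k a b
    darkTile p q a b refl refl = dark-blocks k p q

    cornerTile : ∀ {x y} p q a b → x ≡ a + p * s → y ≡ b + q * s → a < s → b < s →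
      dark n k a b ≡ true → dark n (suc k) x y ≡ dark₁ p q
    cornerTile p q a b x≡ y≡ a<s b<s d =
      trans (darkTile p q a b x≡ y≡ a<s b<s) (trans (cong (dark₁ p q ∧_) d) (∧-identityʳ (dark₁ p q)))

    blankTile : ∀ {x y} p q a b → x ≡ a + p * s → y ≡ b + q * s → a < s → b < s →
      dark n k a b ≡ false → dark n (suc k) x y ≡ false
    blankTile p q a b x≡ y≡ a<s b<s d =
      trans (darkTile p q a b x≡ y≡ a<s b<s) (trans (cong (dark₁ p q ∧_) d) (∧-zeroʳ (dark₁ p q)))

    isVertex-blocks-zero-zero : ∀ p q → isVertex n (suc k) (p * s) (q * s) ≡ isVertex₁ p q
    isVertex-blocks-zero-zero zero zero = dark-origin (suc k)
    isVertex-blocks-zero-zero (suc p) zero = trans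
      (cong (λ x → isVertex n (suc k) x 0) (blockStart-suc p))
      (trans (cong₂ _∨_
        (cornerTile (suc p) 0 0 0 (sym (blockStart-suc p)) refl (0<side k) (0<side k) (dark-origin k))
        (cornerTile p 0 M 0 refl refl (maxIndex<side k) (0<side k) (dark-maxIndex-0 k)))
      (<ᵇ-suc-∨ (p + 0) n))
    isVertex-blocks-zero-zero zero (suc q) = trans
      (cong (isVertex n (suc k) 0) (blockStart-suc q))
      (trans (cong₂ _∨_
        (cornerTile 0 (suc q) 0 0 refl (sym (blockStart-suc q)) (0<side k) (0<side k) (dark-origin k))
        (cornerTile 0 q 0 M refl refl (0<side k) (maxIndex<side k) (dark-0-maxIndex k)))
      (<ᵇ-suc-∨ q n))
    isVertex-blocks-zero-zero (suc p) (suc q) = trans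
      (cong₂ (isVertex n (suc k)) (blockStart-suc p) (blockStart-suc q))
      (trans (cong₂ _∨_
        (cornerTile (suc p) (suc q) 0 0 (sym (blockStart-suc p)) (sym (blockStart-suc q)) (0<side k) (0<side k) (dark-origin k))
        (cong₂ _∨_
          (cornerTile p (suc q) M 0 refl (sym (blockStart-suc q)) (maxIndex<side k) (0<side k) (dark-maxIndex-0 k))
          (cornerTile (suc p) q 0 M (sym (blockStart-suc p)) refl (0<side k) (maxIndex<side k) (dark-0-maxIndex k))))
      (isVertex₁-suc-suc p q))

    isVertex-blocks-suc : ∀ p q a b → suc a < s → b < s →
      isVertex n (suc k) (suc a + p * s) (b + q * s) ≡ dark₁ p q ∧ isVertex n k (suc a) b
    isVertex-blocks-suc p q a (suc b) a<s b<s = ∨-factorˡ (dark₁ p q)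
      (darkTile p q (suc a) (suc b) refl refl a<s b<s)
      (∨-factorˡ (dark₁ p q) (darkTile p q a (suc b) refl refl (<⇒≤ a<s) b<s)
                 (darkTile p q (suc a) b refl refl a<s (<⇒≤ b<s)))
    isVertex-blocks-suc p zero a zero a<s b<s = ∨-factorˡ (dark₁ p 0)
      (darkTile p 0 (suc a) 0 refl refl a<s b<s)
      (darkTile p 0 a 0 refl refl (<⇒≤ a<s) b<s)
    isVertex-blocks-suc p (suc q) a zero a<s b<s = trans
      (cong (isVertex n (suc k) (suc a + p * s)) (blockStart-suc q))
      (∨-factorˡ-∨false (dark₁ p (suc q))
        (darkTile p (suc q) (suc a) 0 refl (sym (blockStart-suc q)) a<s b<s)
        (darkTile p (suc q) a 0 refl (sym (blockStart-suc q)) (<⇒≤ a<s) b<s)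
        (blankTile p q (suc a) M refl refl a<s (maxIndex<side k) (dark-suc-maxIndex k a)))

    isVertex-blocks-zero-suc : ∀ p q b → 0 < s → suc b < s →
      isVertex n (suc k) (p * s) (suc b + q * s) ≡ dark₁ p q ∧ isVertex n k 0 (suc b)
    isVertex-blocks-zero-suc zero q b 0<s b<s = ∨-factorˡ (dark₁ 0 q)
      (darkTile 0 q 0 (suc b) refl refl 0<s b<s)
      (darkTile 0 q 0 b refl refl 0<s (<⇒≤ b<s))
    isVertex-blocks-zero-suc (suc p) q b 0<s b<s = trans
      (cong (λ x → isVertex n (suc k) x (suc b + q * s)) (blockStart-suc p))
      (∨-factorˡ-false∨ (dark₁ (suc p) q)
        (darkTile (suc p) q 0 (suc b) (sym (blockStart-suc p)) refl 0<s b<s)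
        (blankTile p q M (suc b) refl refl (maxIndex<side k) b<s (dark-maxIndex-suc k b))
        (darkTile (suc p) q 0 b (sym (blockStart-suc p)) refl 0<s (<⇒≤ b<s)))

    vertex-blocks : ∀ p q a b → a < s → b < s →
      vertex (suc k) (a + p * s) (b + q * s)
        ≡ origin a b * indicator (isVertex₁ p q) + indicator (dark₁ p q) * nonOriginVertex k a b
    vertex-blocks p q zero    zero    _   _   = begin
      indicator (isVertex n (suc k) (p * s) (q * s))
        ≡⟨ cong indicator (isVertex-blocks-zero-zero p q) ⟩
      indicator (isVertex₁ p q)
        ≡⟨ sym (trans (cong₂ _+_ (*-identityˡ x) (*-zeroʳ (indicator (dark₁ p q)))) (+-identityʳ x)) ⟩
      1 * indicator (isVertex₁ p q) + indicator (dark₁ p q) * 0 ∎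
      where x = indicator (isVertex₁ p q)
    vertex-blocks p q (suc a) b       a<s b<s =
      trans (cong indicator (isVertex-blocks-suc p q a b a<s b<s))
            (indicator-∧ (dark₁ p q) (isVertex n k (suc a) b))
    vertex-blocks p q zero    (suc b) a<s b<s =
      trans (cong indicator (isVertex-blocks-zero-suc p q b a<s b<s))
            (indicator-∧ (dark₁ p q) (isVertex n k 0 (suc b)))

  overallSize-suc : ∀ k →
    overallSize n (suc k) ≡ triangle (suc n) + triangle n * ∑² (side n k) (nonOriginVertex k)
  overallSize-suc k = begin
    overallSize n (suc k)
      ≡⟨ sum-grid≡∑² (suc s′) (vertex (suc k)) ⟩
    ∑² (suc s′) (vertex (suc k))
      ≡⟨ sym (∑²-extend (suc s′) (maxIndex k) (vertex (suc k)) outside≗0) ⟩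
    ∑² (suc s′ + maxIndex k) (vertex (suc k))
      ≡⟨ cong (λ L → ∑² L (vertex (suc k))) blocksCover ⟩
    ∑² (suc n * s) (vertex (suc k))
      ≡⟨ ∑²-blocks (suc n) s (vertex (suc k)) ⟩
    ∑² (suc n) (λ p q → ∑² s (λ a b → vertex (suc k) (a + p * s) (b + q * s)))
      ≡⟨ ∑²-cong (suc n) (λ p q _ _ → trans (∑²-cong s (vertex-blocks k p q)) (blockSum p q)) ⟩
    ∑² (suc n) (λ p q → indicator (isVertex₁ p q) + indicator (dark₁ p q) * w)
      ≡⟨ ∑²-distrib-+ (suc n) (λ p q → indicator (isVertex₁ p q)) (λ p q → indicator (dark₁ p q) * w) ⟩
    ∑² (suc n) (λ p q → indicator (isVertex₁ p q)) + ∑² (suc n) (λ p q → indicator (dark₁ p q) * w)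
      ≡⟨ cong (∑² (suc n) (λ p q → indicator (isVertex₁ p q)) +_) (sym (*-distribʳ-∑² (suc n) w (λ p q → indicator (dark₁ p q)))) ⟩
    ∑² (suc n) (λ p q → indicator (isVertex₁ p q)) + ∑² (suc n) (λ p q → indicator (dark₁ p q)) * w
      ≡⟨ cong₂ (λ x y → x + y * w) (∑²-triangle (suc n) (suc n) ≤-refl) (∑²-triangle n (suc n) (n≤1+n n)) ⟩
    triangle (suc n) + triangle n * w ∎
    where
    s = side n k
    s′ = side n (suc k)
    w = ∑² s (nonOriginVertex k)
    instance _ = side-nonZero k

    outside≗0 : ∀ a b → suc s′ ≤ a ⊎ suc s′ ≤ b → vertex (suc k) a b ≡ 0
    outside≗0 a b (inj₁ s′<a) = vertex-outside (suc k) a b (≤-trans s′<a (m≤m+n a b))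
    outside≗0 a b (inj₂ s′<b) = vertex-outside (suc k) a b (≤-trans s′<b (m≤n+m b a))

    blocksCover : suc s′ + maxIndex k ≡ suc n * s
    blocksCover = begin
      suc (s′ + maxIndex k)  ≡⟨ sym (+-suc s′ (maxIndex k)) ⟩
      s′ + suc (maxIndex k)  ≡⟨ cong (s′ +_) (suc-maxIndex k) ⟩
      s′ + s                 ≡⟨ +-comm s′ s ⟩
      suc n * s              ∎

    blockSum : ∀ p q → ∑² s (λ a b → origin a b * indicator (isVertex₁ p q) + indicator (dark₁ p q) * nonOriginVertex k a b)
                        ≡ indicator (isVertex₁ p q) + indicator (dark₁ p q) * w
    blockSum p q = begin
      ∑² s (λ a b → origin a b * x + y * nonOriginVertex k a b)
        ≡⟨ ∑²-distrib-+ s (λ a b → origin a b * x) (λ a b → y * nonOriginVertex k a b) ⟩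
      ∑² s (λ a b → origin a b * x) + ∑² s (λ a b → y * nonOriginVertex k a b)
        ≡⟨ cong₂ _+_ (sym (*-distribʳ-∑² s x origin)) (sym (*-distribˡ-∑² s y (nonOriginVertex k))) ⟩
      ∑² s origin * x + y * w
        ≡⟨ cong (λ z → z * x + y * w) (∑²-origin s) ⟩
      1 * x + y * w
        ≡⟨ cong (_+ y * w) (*-identityˡ x) ⟩
      x + y * w ∎
      where
      x = indicator (isVertex₁ p q)
      y = indicator (dark₁ p q)

  overallSize-one : overallSize n 1 ≡ T (n + 1)
  overallSize-one = begin
    overallSize n 1                     ≡⟨ overallSize-suc 0 ⟩
    triangle (suc n) + triangle n * 0   ≡⟨ cong (triangle (suc n) +_) (*-zeroʳ (triangle n)) ⟩
    triangle (suc n) + 0                ≡⟨ +-identityʳ _ ⟩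
    triangle (suc n)                    ≡⟨ cong triangle (+-comm 1 n) ⟩
    triangle (n + 1)                    ≡⟨ sym (T≡triangle (n + 1)) ⟩
    T (n + 1)                           ∎

  overallSize-recurrence : ∀ k → overallSize n (suc k) + n ^ 2 ≡ overallSize n k * T n + 1
  overallSize-recurrence k = begin
    overallSize n (suc k) + n ^ 2
      ≡⟨ cong (_+ n ^ 2) (overallSize-suc k) ⟩
    triangle (suc n) + triangle n * w + n ^ 2
      ≡⟨ recurrence-arith n w ⟩
    (w + 3) * triangle n + 1
      ≡⟨ cong₂ (λ x y → x * y + 1) (sym (overallSize≡∑²nonOrigin+3 k)) (sym (T≡triangle n)) ⟩
    overallSize n k * T n + 1 ∎
    where w = ∑² (side n k) (nonOriginVertex k)

  overallSize-closedForm : ∀ k → (n + 2) * overallSize n k ≡ (n + 4) * triangle n ^ k + 2 * (n + 1)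
  overallSize-closedForm zero    = base n
    where
    base : ∀ n → (n + 2) * 3 ≡ (n + 4) * 1 + 2 * (n + 1)
    base = solve-∀
  overallSize-closedForm (suc k) = begin
    (n + 2) * overallSize n (suc k)
      ≡⟨ cong ((n + 2) *_) (overallSize-suc k) ⟩
    (n + 2) * (triangle (suc n) + triangle n * w)
      ≡⟨ closedForm-step n w (triangle n ^ k) ih ⟩
    (n + 4) * triangle n ^ suc k + 2 * (n + 1) ∎
    where
    w = ∑² (side n k) (nonOriginVertex k)
    ih : (n + 2) * (w + 3) ≡ (n + 4) * triangle n ^ k + 2 * (n + 1)
    ih = trans (cong ((n + 2) *_) (sym (overallSize≡∑²nonOrigin+3 k))) (overallSize-closedForm k)

mainTheorem1 : (n : ℕ) → 2 ≤ n →
    (overallSize n 1 ≡ T (n + 1))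
    × ((k : ℕ) → 2 ≤ k → overallSize n k + n ^ 2 ≡ overallSize n (k ∸ 1) * T n + 1)
    × ((k : ℕ) → 1 ≤ k → (n + 2) * overallSize n k ≡ (n + 4) * T n ^ k + 2 * (n + 1))
mainTheorem1 zero    ()
mainTheorem1 (suc m) _ = overallSize-one , recurrence , closedForm
  where
  open OverallGraph m
  recurrence : (k : ℕ) → 2 ≤ k → overallSize (suc m) k + suc m ^ 2 ≡ overallSize (suc m) (k ∸ 1) * T (suc m) + 1
  recurrence (suc zero)    (s≤s ())
  recurrence (suc (suc k)) _ = overallSize-recurrence (suc k)
  closedForm : (k : ℕ) → 1 ≤ k → (suc m + 2) * overallSize (suc m) k ≡ (suc m + 4) * T (suc m) ^ k + 2 * (suc m + 1)
  closedForm k _ = trans (overallSize-closedForm k)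
    (cong (λ t → (suc m + 4) * t ^ k + 2 * (suc m + 1)) (sym (T≡triangle (suc m))))
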